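{- In Maker-Breaker Incidence (as partisan scoring games), the following equivalences hold: $P^L_1\equiv P^L_2\equiv 0$; $2P^L_3\equiv 1$; $P^L_4\equiv P^L_3$; $2P^L_5+P^L_3\equiv 2$.
   Context: Partisan scoring positional games: a finite hypergraph whose hyperedges are colored blue, red or green; Left and Right alternately claim a not yet claimed vertex until all are claimed; Left's score counts blue or green hyperedges fully claimed by her, Right's counts red or green hyperedges fully claimed by him, and the final value is Left's score minus Right's (Left maximizes, Right minimizes). $Ls(X)$ (resp. $Rs(X)$) is the optimal final value of a position $X$ when Left (resp. Right) moves first. $X+Y$ is the game on the disjoint union; $mX$ is the sum of $m$ copies of $X$. For an integer $k$, $k$ denotes the game with no moves and final value $k$, and $X+k$ is $X$ with $k$ added to its final value. $X\equiv Y$ means $Ls(Z+X)=Ls(Z+Y)$ and $Rs(Z+X)=Rs(Z+Y)$ for every position $Z$ of a partisan scoring positional game. $P^L_n$ is the path on $n$ vertices with all edges blue (i.e. Maker-Breaker Incidence on the path: only Left scores, one point per edge with both endpoints claimed by her). -}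

module Defs where

open import Data.Nat using (ℕ; zero; suc; _+_)
open import Data.Integer using (ℤ; _⊔_; _⊓_; 0ℤ; 1ℤ; -_) renaming (_+_ to _+ℤ_)
open import Data.Fin using (Fin; zero; suc; _↑ˡ_; _↑ʳ_)
open import Data.List using (List; []; _∷_; map; filter; foldr; _++_; allFin)
open import Data.Bool using (Bool; true; false; _∧_; if_then_else_)
open import Data.Product using (_×_; _,_)
open import Relation.Nullary using (yes; no)
open import Relation.Binary.PropositionalEquality using (_≡_)

data Colour : Set where
  blue red green : Colour

data Player : Set where
  left right : Player

data Owner : Set where
  free : Owner
  ownedBy : Player → Owner

-- A position: a finite hypergraph on vertex set Fin n with coloured
-- hyperedges (each hyperedge = list of its vertices), all vertices
-- unclaimed, plus an integer offset added to the final value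
-- (the offset realises the games k and X + k).
record Game : Set where
  constructor mkGame
  field
    size   : ℕ
    edges  : List (Colour × List (Fin size))
    offset : ℤ
open Game public

allB : {A : Set} → (A → Bool) → List A → Bool
allB p [] = true
allB p (x ∷ xs) = p x ∧ allB p xs

isFree : Owner → Bool
isFree free = true
isFree (ownedBy _) = false

ownedByP : Player → Owner → Bool
ownedByP left  (ownedBy left)  = true
ownedByP right (ownedBy right) = true
ownedByP _     _               = false

countsFor : Player → Colour → Bool
countsFor left  blue  = true
countsFor left  green = true
countsFor right red   = true
countsFor right green = true
countsFor _     _     = false

edgePoint : {n : ℕ} → (Fin n → Owner) → Player → Colour × List (Fin n) → ℤ
edgePoint σ p (c , vs) =
  if countsFor p c ∧ allB (λ v → ownedByP p (σ v)) vs then 1ℤ else 0ℤ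

score : (G : Game) → (Fin (size G) → Owner) → ℤ
score G σ = foldr (λ e acc → edgePoint σ left e +ℤ (- edgePoint σ right e) +ℤ acc)
                  (offset G) (edges G)

opponent : Player → Player
opponent left = right
opponent right = left

opt : Player → ℤ → ℤ → ℤ
opt left  a b = a ⊔ b
opt right a b = a ⊓ b

best : {A : Set} → Player → List A → (A → ℤ) → ℤ → ℤ
best p []       f d = d
best p (v ∷ vs) f d = foldr (λ w acc → opt p (f w) acc) (f v) vs

claim : {n : ℕ} → (Fin n → Owner) → Fin n → Player → (Fin n → Owner)
claim σ v p w with v Data.Fin.≟ w
... | yes _ = ownedBy p
... | no  _ = σ w

freeVertices : {n : ℕ} → (Fin n → Owner) → List (Fin n)
freeVertices {n} σ = filter (λ v → Data.Bool._≟_ (isFree (σ v)) true) (allFin n)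

-- optimal value with player p to move, with fuel k (k ≥ number of free
-- vertices suffices; play ends when no vertex is free)
value : (G : Game) → ℕ → Player → (Fin (size G) → Owner) → ℤ
value G zero    p σ = score G σ
value G (suc k) p σ =
  best p (freeVertices σ) (λ v → value G k (opponent p) (claim σ v p)) (score G σ)

Ls : Game → ℤ
Ls G = value G (size G) left (λ _ → free)

Rs : Game → ℤ
Rs G = value G (size G) right (λ _ → free)

_⊕_ : Game → Game → Game
mkGame m eX oX ⊕ mkGame n eY oY =
  mkGame (m + n)
         (map (λ { (c , vs) → c , map (_↑ˡ n) vs }) eX
           ++ map (λ { (c , vs) → c , map (m ↑ʳ_) vs }) eY)
         (oX +ℤ oY)

const : ℤ → Game
const k = mkGame 0 [] k

copies : ℕ → Game → Game
copies zero    X = const 0ℤ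
copies (suc m) X = copies m X ⊕ X

_≈g_ : Game → Game → Set
X ≈g Y = ∀ (Z : Game) → (Ls (Z ⊕ X) ≡ Ls (Z ⊕ Y)) × (Rs (Z ⊕ X) ≡ Rs (Z ⊕ Y))

pathEdges : (n : ℕ) → List (List (Fin n))
pathEdges zero = []
pathEdges (suc zero) = []
pathEdges (suc (suc n)) = (zero ∷ suc zero ∷ []) ∷ map (map suc) (pathEdges (suc n))

PL : ℕ → Game
PL n = mkGame n (map (λ vs → blue , vs) (pathEdges n)) 0ℤ

-- Owning a vertex can only help its owner, so by strategy stealing every position of a partisan
-- scoring positional game, and every position reachable from it, has Rs ≤ Ls.  For game trees with
-- this property the values of a sum satisfy
--   Ls G + Rs H ≤ Ls (G + H) ≤ Ls G + Ls H   and   Rs G + Rs H ≤ Rs (G + H) ≤ Rs G + Ls H,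
-- so a position with Ls = Rs = k acts like the number k in every sum, and X ≡ Y as soon as
-- X − Y (X plus Y with the roles of the players exchanged) has both values 0, because Y − Y has.
-- Each equivalence then comes down to evaluating small positions, after replacing P^L_5 by its
-- canonical form {{2 | 1} | 0} in the last one.

module Submission where

open import Defs
open import Data.Integer using (+_)
open import Data.Product using (_×_)

open import Data.Bool using (Bool; true; false; _∧_; if_then_else_)
import Data.Bool as Bool
open import Data.Empty using (⊥; ⊥-elim)
open import Data.Fin as Fin using (Fin; zero; suc; splitAt; _↑ˡ_; _↑ʳ_)
open import Data.Fin.Properties
  using (splitAt-↑ˡ; splitAt-↑ʳ; ↑ˡ-injective; ↑ʳ-injective; splitAt⁻¹-↑ˡ; splitAt⁻¹-↑ʳ)
  renaming (suc-injective to Fin-suc-injective)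
open import Data.Integer using (ℤ; _⊔_; _⊓_; -_; _≤_; +≤+; 0ℤ; 1ℤ) renaming (_+_ to _⊹_)
open import Data.Integer.Properties
  using (≤-refl; ≤-trans; ≤-reflexive; ≤-antisym; +-mono-≤; +-monoˡ-≤; +-monoʳ-≤; neg-mono-≤;
         +-comm; +-assoc; +-inverseʳ; +-identityʳ; +-commutativeSemigroup;
         i≤i⊔j; i≤j⊔i; ⊔-lub; ⊔-sel; i⊓j≤i; i⊓j≤j; ⊓-glb; ⊓-sel; neg-distrib-⊓-⊔; neg-distrib-⊔-⊓)
open import Data.List using (List; []; _∷_; length; lookup; filter; foldr; map; tabulate; allFin)
open import Data.List.Membership.Propositional using (_∈_)
open import Data.List.Membership.Propositional.Properties using (∈-lookup; ∈-filter⁺; ∈-filter⁻; ∈-allFin)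
open import Data.List.Properties using (foldr-++; foldr-fusion)
open import Data.List.Relation.Unary.Any using (here; there; index)
open import Data.List.Relation.Unary.Any.Properties using (lookup-index)
open import Data.Nat using (ℕ; zero; suc; _+_; pred; z≤n; s≤s)
import Data.Nat.Properties as ℕ
open import Data.Product using (∃; _,_; proj₁; proj₂)
open import Data.Sum using (_⊎_; inj₁; inj₂; [_,_]′)
open import Function using (_∘_)
open import Relation.Nullary using (yes; no; Dec)
open import Relation.Binary.PropositionalEquality

open import Algebra.Properties.CommutativeSemigroup +-commutativeSemigroup using (x∙yz≈y∙xz)


-- Game trees

maxF : (n : ℕ) → (Fin (suc n) → ℤ) → ℤ
maxF zero    f = f zero
maxF (suc n) f = f zero ⊔ maxF n (λ i → f (suc i))

minF : (n : ℕ) → (Fin (suc n) → ℤ) → ℤ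
minF zero    f = f zero
minF (suc n) f = f zero ⊓ minF n (λ i → f (suc i))

maxF-upper : ∀ n f (i : Fin (suc n)) → f i ≤ maxF n f
maxF-upper zero    f zero    = ≤-refl
maxF-upper (suc n) f zero    = i≤i⊔j _ _
maxF-upper (suc n) f (suc i) = ≤-trans (maxF-upper n (λ i → f (suc i)) i) (i≤j⊔i _ _)

maxF-least : ∀ n f c → (∀ i → f i ≤ c) → maxF n f ≤ c
maxF-least zero    f c h = h zero
maxF-least (suc n) f c h = ⊔-lub (h zero) (maxF-least n (λ i → f (suc i)) c (λ i → h (suc i)))

maxF-attained : ∀ n f → ∃ λ i → maxF n f ≡ f i
maxF-attained zero    f = zero , refl
maxF-attained (suc n) f with ⊔-sel (f zero) (maxF n (λ i → f (suc i)))
... | inj₁ e = zero , e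
... | inj₂ e with maxF-attained n (λ i → f (suc i))
...   | i , e′ = suc i , trans e e′

minF-lower : ∀ n f (i : Fin (suc n)) → minF n f ≤ f i
minF-lower zero    f zero    = ≤-refl
minF-lower (suc n) f zero    = i⊓j≤i _ _
minF-lower (suc n) f (suc i) = ≤-trans (i⊓j≤j _ _) (minF-lower n (λ i → f (suc i)) i)

minF-greatest : ∀ n f c → (∀ i → c ≤ f i) → c ≤ minF n f
minF-greatest zero    f c h = h zero
minF-greatest (suc n) f c h = ⊓-glb (h zero) (minF-greatest n (λ i → f (suc i)) c (λ i → h (suc i)))

minF-attained : ∀ n f → ∃ λ i → minF n f ≡ f i
minF-attained zero    f = zero , refl
minF-attained (suc n) f with ⊓-sel (f zero) (minF n (λ i → f (suc i)))
... | inj₁ e = zero , e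
... | inj₂ e with minF-attained n (λ i → f (suc i))
...   | i , e′ = suc i , trans e e′

maxF-cong : ∀ n {f f′} → (∀ i → f i ≡ f′ i) → maxF n f ≡ maxF n f′
maxF-cong zero    h = h zero
maxF-cong (suc n) h = cong₂ _⊔_ (h zero) (maxF-cong n (λ i → h (suc i)))

minF-cong : ∀ n {f f′} → (∀ i → f i ≡ f′ i) → minF n f ≡ minF n f′
minF-cong zero    h = h zero
minF-cong (suc n) h = cong₂ _⊓_ (h zero) (minF-cong n (λ i → h (suc i)))

maxF-neg : ∀ n f → maxF n (λ i → - f i) ≡ - minF n f
maxF-neg zero    f = refl
maxF-neg (suc n) f = trans (cong (- f zero ⊔_) (maxF-neg n (λ i → f (suc i)))) (sym (neg-distrib-⊓-⊔ _ _))

minF-neg : ∀ n f → minF n (λ i → - f i) ≡ - maxF n f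
minF-neg zero    f = refl
minF-neg (suc n) f = trans (cong (- f zero ⊓_) (minF-neg n (λ i → f (suc i)))) (sym (neg-distrib-⊔-⊓ _ _))

-- Both players have the same n moves (claiming one of the n free vertices); the integer is the
-- final value, used once n = 0.
data Tree : Set where
  node : ℤ → (n : ℕ) → (Fin n → Tree) → (Fin n → Tree) → Tree

stop : Tree → ℤ
stop (node s _ _ _) = s

moves : Tree → ℕ
moves (node _ n _ _) = n

option : Player → (t : Tree) → Fin (moves t) → Tree
option left  (node _ _ f _) = f
option right (node _ _ _ g) = g

leaf : ℤ → Tree
leaf k = node k 0 (λ ()) (λ ())

mutual
  Lv : Tree → ℤ
  Lv (node s zero    f g) = s
  Lv (node s (suc n) f g) = maxF n (λ i → Rv (f i))

  Rv : Tree → ℤ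
  Rv (node s zero    f g) = s
  Rv (node s (suc n) f g) = minF n (λ i → Lv (g i))

Lv-upper : ∀ t i → Rv (option left t i) ≤ Lv t
Lv-upper (node s (suc n) f g) = maxF-upper n (λ i → Rv (f i))

Lv-least : ∀ t c → Fin (moves t) → (∀ i → Rv (option left t i) ≤ c) → Lv t ≤ c
Lv-least (node s (suc n) f g) c _ = maxF-least n (λ i → Rv (f i)) c

Lv-attained : ∀ t → Fin (moves t) → ∃ λ i → Lv t ≡ Rv (option left t i)
Lv-attained (node s (suc n) f g) _ = maxF-attained n (λ i → Rv (f i))

Rv-lower : ∀ t i → Rv t ≤ Lv (option right t i)
Rv-lower (node s (suc n) f g) = minF-lower n (λ i → Lv (g i))

Rv-greatest : ∀ t c → Fin (moves t) → (∀ i → c ≤ Lv (option right t i)) → c ≤ Rv t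
Rv-greatest (node s (suc n) f g) c _ = minF-greatest n (λ i → Lv (g i)) c

Rv-attained : ∀ t → Fin (moves t) → ∃ λ i → Rv t ≡ Lv (option right t i)
Rv-attained (node s (suc n) f g) _ = minF-attained n (λ i → Lv (g i))

infixl 6 _⊞_
_⊞_ : Tree → Tree → Tree
G@(node s n f g) ⊞ H@(node t m h k) =
  node (s ⊹ t) (n + m)
    (λ i → [ (λ a → f a ⊞ H) , (λ b → G ⊞ h b) ]′ (splitAt n i))
    (λ i → [ (λ a → g a ⊞ H) , (λ b → G ⊞ k b) ]′ (splitAt n i))

stop-⊞ : ∀ G H → stop (G ⊞ H) ≡ stop G ⊹ stop H
stop-⊞ (node _ _ _ _) (node _ _ _ _) = refl

option-⊞-↑ˡ : ∀ p G H a → ∃ λ i → option p (G ⊞ H) i ≡ option p G a ⊞ H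
option-⊞-↑ˡ left  (node s n f g) H@(node t m h k) a = a ↑ˡ m , cong [ (λ a → f a ⊞ H) , _ ]′ (splitAt-↑ˡ n a m)
option-⊞-↑ˡ right (node s n f g) H@(node t m h k) a = a ↑ˡ m , cong [ (λ a → g a ⊞ H) , _ ]′ (splitAt-↑ˡ n a m)

option-⊞-↑ʳ : ∀ p G H b → ∃ λ i → option p (G ⊞ H) i ≡ G ⊞ option p H b
option-⊞-↑ʳ left  G@(node s n f g) (node t m h k) b = n ↑ʳ b , cong [ _ , (λ b → G ⊞ h b) ]′ (splitAt-↑ʳ n m b)
option-⊞-↑ʳ right G@(node s n f g) (node t m h k) b = n ↑ʳ b , cong [ _ , (λ b → G ⊞ k b) ]′ (splitAt-↑ʳ n m b)

option-⊞-elim : ∀ p G H (P : Tree → Set) →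
  (∀ a → P (option p G a ⊞ H)) → (∀ b → P (G ⊞ option p H b)) → ∀ i → P (option p (G ⊞ H) i)
option-⊞-elim left  (node s n f g) (node t m h k) P onG onH i with splitAt n i
... | inj₁ a = onG a
... | inj₂ b = onH b
option-⊞-elim right (node s n f g) (node t m h k) P onG onH i with splitAt n i
... | inj₁ a = onG a
... | inj₂ b = onH b

option-⊞-introˡ : ∀ p G H (P : Tree → Set) a → P (option p G a ⊞ H) → ∃ λ i → P (option p (G ⊞ H) i)
option-⊞-introˡ p G H P a x with option-⊞-↑ˡ p G H a
... | i , e = i , subst P (sym e) x

option-⊞-introʳ : ∀ p G H (P : Tree → Set) b → P (G ⊞ option p H b) → ∃ λ i → P (option p (G ⊞ H) i)
option-⊞-introʳ p G H P b x with option-⊞-↑ʳ p G H b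
... | i , e = i , subst P (sym e) x

Lv-⊞-upperˡ : ∀ G H a → Rv (option left G a ⊞ H) ≤ Lv (G ⊞ H)
Lv-⊞-upperˡ G H a with option-⊞-↑ˡ left G H a
... | i , e = subst (λ x → Rv x ≤ Lv (G ⊞ H)) e (Lv-upper (G ⊞ H) i)

Lv-⊞-upperʳ : ∀ G H b → Rv (G ⊞ option left H b) ≤ Lv (G ⊞ H)
Lv-⊞-upperʳ G H b with option-⊞-↑ʳ left G H b
... | i , e = subst (λ x → Rv x ≤ Lv (G ⊞ H)) e (Lv-upper (G ⊞ H) i)

Rv-⊞-lowerˡ : ∀ G H a → Rv (G ⊞ H) ≤ Lv (option right G a ⊞ H)
Rv-⊞-lowerˡ G H a with option-⊞-↑ˡ right G H a
... | i , e = subst (λ x → Rv (G ⊞ H) ≤ Lv x) e (Rv-lower (G ⊞ H) i)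

Rv-⊞-lowerʳ : ∀ G H b → Rv (G ⊞ H) ≤ Lv (G ⊞ option right H b)
Rv-⊞-lowerʳ G H b with option-⊞-↑ʳ right G H b
... | i , e = subst (λ x → Rv (G ⊞ H) ≤ Lv x) e (Rv-lower (G ⊞ H) i)

Lv-⊞-least : ∀ G H c → Fin (moves (G ⊞ H)) →
  (∀ a → Rv (option left G a ⊞ H) ≤ c) → (∀ b → Rv (G ⊞ option left H b) ≤ c) → Lv (G ⊞ H) ≤ c
Lv-⊞-least G H c i₀ onG onH = Lv-least (G ⊞ H) c i₀ (option-⊞-elim left G H (λ x → Rv x ≤ c) onG onH)

Rv-⊞-greatest : ∀ G H c → Fin (moves (G ⊞ H)) →
  (∀ a → c ≤ Lv (option right G a ⊞ H)) → (∀ b → c ≤ Lv (G ⊞ option right H b)) → c ≤ Rv (G ⊞ H)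
Rv-⊞-greatest G H c i₀ onG onH = Rv-greatest (G ⊞ H) c i₀ (option-⊞-elim right G H (λ x → c ≤ Lv x) onG onH)

FirstMoverAdvantage : Tree → Set
FirstMoverAdvantage t@(node s n f g) =
  (Rv t ≤ Lv t) × (∀ i → FirstMoverAdvantage (f i)) × (∀ i → FirstMoverAdvantage (g i))

fma-root : ∀ t → FirstMoverAdvantage t → Rv t ≤ Lv t
fma-root (node s n f g) = proj₁

fma-option : ∀ p t → FirstMoverAdvantage t → ∀ i → FirstMoverAdvantage (option p t i)
fma-option left  (node s n f g) = proj₁ ∘ proj₂
fma-option right (node s n f g) = proj₂ ∘ proj₂

fma-leaf : ∀ k → FirstMoverAdvantage (leaf k)
fma-leaf k = ≤-refl , (λ ()) , (λ ())

-- Each bound is witnessed by an optimal first move in one component; if that component has no moves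
-- left, the first-mover advantage of the other lets the player start there instead.
mutual
  Lv+Rv≤Lv-⊞ : ∀ G H → FirstMoverAdvantage G → FirstMoverAdvantage H → Lv G ⊹ Rv H ≤ Lv (G ⊞ H)
  Lv+Rv≤Lv-⊞ (node s zero f g) (node t zero h k) _ _ = ≤-refl
  Lv+Rv≤Lv-⊞ G@(node s zero f g) H@(node t (suc m) h k) aG aH =
    let (b , e) = Lv-attained H zero in
    ≤-trans (+-monoʳ-≤ s (fma-root H aH))
   (≤-trans (≤-reflexive (cong (s ⊹_) e))
   (≤-trans (Rv+Rv≤Rv-⊞ G (h b) aG (fma-option left H aH b)) (Lv-⊞-upperʳ G H b)))
  Lv+Rv≤Lv-⊞ G@(node s (suc n) f g) H aG aH =
    let (a , e) = Lv-attained G zero in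
    ≤-trans (≤-reflexive (cong (_⊹ Rv H) e))
   (≤-trans (Rv+Rv≤Rv-⊞ (f a) H (fma-option left G aG a) aH) (Lv-⊞-upperˡ G H a))

  Rv+Lv≤Lv-⊞ : ∀ G H → FirstMoverAdvantage G → FirstMoverAdvantage H → Rv G ⊹ Lv H ≤ Lv (G ⊞ H)
  Rv+Lv≤Lv-⊞ (node s zero f g) (node t zero h k) _ _ = ≤-refl
  Rv+Lv≤Lv-⊞ G@(node s (suc n) f g) H@(node t zero h k) aG aH =
    let (a , e) = Lv-attained G zero in
    ≤-trans (+-monoˡ-≤ t (fma-root G aG))
   (≤-trans (≤-reflexive (cong (_⊹ t) e))
   (≤-trans (Rv+Rv≤Rv-⊞ (f a) H (fma-option left G aG a) aH) (Lv-⊞-upperˡ G H a)))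
  Rv+Lv≤Lv-⊞ G H@(node t (suc m) h k) aG aH =
    let (b , e) = Lv-attained H zero in
    ≤-trans (≤-reflexive (cong (Rv G ⊹_) e))
   (≤-trans (Rv+Rv≤Rv-⊞ G (h b) aG (fma-option left H aH b)) (Lv-⊞-upperʳ G H b))

  Rv+Rv≤Rv-⊞ : ∀ G H → FirstMoverAdvantage G → FirstMoverAdvantage H → Rv G ⊹ Rv H ≤ Rv (G ⊞ H)
  Rv+Rv≤Rv-⊞ (node s zero f g) (node t zero h k) _ _ = ≤-refl
  Rv+Rv≤Rv-⊞ G@(node s (suc n) f g) H@(node t m h k) aG aH = Rv+Rv≤Rv-⊞-moving G H aG aH zero
  Rv+Rv≤Rv-⊞ G@(node s zero f g) H@(node t (suc m) h k) aG aH = Rv+Rv≤Rv-⊞-moving G H aG aH zero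

  Rv+Rv≤Rv-⊞-moving : ∀ G H → FirstMoverAdvantage G → FirstMoverAdvantage H →
    Fin (moves (G ⊞ H)) → Rv G ⊹ Rv H ≤ Rv (G ⊞ H)
  Rv+Rv≤Rv-⊞-moving G@(node s n f g) H@(node t m h k) aG aH i₀ = Rv-⊞-greatest G H _ i₀
    (λ a → ≤-trans (+-monoˡ-≤ (Rv H) (Rv-lower G a)) (Lv+Rv≤Lv-⊞ (g a) H (fma-option right G aG a) aH))
    (λ b → ≤-trans (+-monoʳ-≤ (Rv G) (Rv-lower H b)) (Rv+Lv≤Lv-⊞ G (k b) aG (fma-option right H aH b)))

mutual
  Lv-⊞≤Lv+Lv : ∀ G H → FirstMoverAdvantage G → FirstMoverAdvantage H → Lv (G ⊞ H) ≤ Lv G ⊹ Lv H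
  Lv-⊞≤Lv+Lv (node s zero f g) (node t zero h k) _ _ = ≤-refl
  Lv-⊞≤Lv+Lv G@(node s (suc n) f g) H@(node t m h k) aG aH = Lv-⊞≤Lv+Lv-moving G H aG aH zero
  Lv-⊞≤Lv+Lv G@(node s zero f g) H@(node t (suc m) h k) aG aH = Lv-⊞≤Lv+Lv-moving G H aG aH zero

  Lv-⊞≤Lv+Lv-moving : ∀ G H → FirstMoverAdvantage G → FirstMoverAdvantage H →
    Fin (moves (G ⊞ H)) → Lv (G ⊞ H) ≤ Lv G ⊹ Lv H
  Lv-⊞≤Lv+Lv-moving G@(node s n f g) H@(node t m h k) aG aH i₀ = Lv-⊞-least G H _ i₀
    (λ a → ≤-trans (Rv-⊞≤Rv+Lv (f a) H (fma-option left G aG a) aH) (+-monoˡ-≤ (Lv H) (Lv-upper G a)))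
    (λ b → ≤-trans (Rv-⊞≤Lv+Rv G (h b) aG (fma-option left H aH b)) (+-monoʳ-≤ (Lv G) (Lv-upper H b)))

  Rv-⊞≤Rv+Lv : ∀ G H → FirstMoverAdvantage G → FirstMoverAdvantage H → Rv (G ⊞ H) ≤ Rv G ⊹ Lv H
  Rv-⊞≤Rv+Lv (node s zero f g) (node t zero h k) _ _ = ≤-refl
  Rv-⊞≤Rv+Lv G@(node s zero f g) H@(node t (suc m) h k) aG aH =
    let (b , e) = Rv-attained H zero in
    ≤-trans (Rv-⊞-lowerʳ G H b)
   (≤-trans (Lv-⊞≤Lv+Lv G (k b) aG (fma-option right H aH b))
   (≤-trans (≤-reflexive (cong (s ⊹_) (sym e))) (+-monoʳ-≤ s (fma-root H aH))))
  Rv-⊞≤Rv+Lv G@(node s (suc n) f g) H aG aH =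
    let (a , e) = Rv-attained G zero in
    ≤-trans (Rv-⊞-lowerˡ G H a)
   (≤-trans (Lv-⊞≤Lv+Lv (g a) H (fma-option right G aG a) aH) (≤-reflexive (cong (_⊹ Lv H) (sym e))))

  Rv-⊞≤Lv+Rv : ∀ G H → FirstMoverAdvantage G → FirstMoverAdvantage H → Rv (G ⊞ H) ≤ Lv G ⊹ Rv H
  Rv-⊞≤Lv+Rv (node s zero f g) (node t zero h k) _ _ = ≤-refl
  Rv-⊞≤Lv+Rv G@(node s (suc n) f g) H@(node t zero h k) aG aH =
    let (a , e) = Rv-attained G zero in
    ≤-trans (Rv-⊞-lowerˡ G H a)
   (≤-trans (Lv-⊞≤Lv+Lv (g a) H (fma-option right G aG a) aH)
   (≤-trans (≤-reflexive (cong (_⊹ t) (sym e))) (+-monoˡ-≤ t (fma-root G aG))))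
  Rv-⊞≤Lv+Rv G H@(node t (suc m) h k) aG aH =
    let (b , e) = Rv-attained H zero in
    ≤-trans (Rv-⊞-lowerʳ G H b)
   (≤-trans (Lv-⊞≤Lv+Lv G (k b) aG (fma-option right H aH b)) (≤-reflexive (cong (Lv G ⊹_) (sym e))))

fma-⊞ : ∀ G H → FirstMoverAdvantage G → FirstMoverAdvantage H → FirstMoverAdvantage (G ⊞ H)
fma-⊞ G@(node s n f g) H@(node t m h k) aG aH =
  ≤-trans (Rv-⊞≤Lv+Rv G H aG aH) (Lv+Rv≤Lv-⊞ G H aG aH) ,
  option-⊞-elim left G H FirstMoverAdvantage
    (λ a → fma-⊞ (f a) H (fma-option left G aG a) aH) (λ b → fma-⊞ G (h b) aG (fma-option left H aH b)) ,
  option-⊞-elim right G H FirstMoverAdvantage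
    (λ a → fma-⊞ (g a) H (fma-option right G aG a) aH) (λ b → fma-⊞ G (k b) aG (fma-option right H aH b))

neg : Tree → Tree
neg (node s n f g) = node (- s) n (λ i → neg (g i)) (λ i → neg (f i))

mutual
  Lv-neg : ∀ t → Lv (neg t) ≡ - Rv t
  Lv-neg (node s zero    f g) = refl
  Lv-neg (node s (suc n) f g) = trans (maxF-cong n (λ i → Rv-neg (g i))) (maxF-neg n (λ i → Lv (g i)))

  Rv-neg : ∀ t → Rv (neg t) ≡ - Lv t
  Rv-neg (node s zero    f g) = refl
  Rv-neg (node s (suc n) f g) = trans (minF-cong n (λ i → Lv-neg (f i))) (minF-neg n (λ i → Rv (f i)))

fma-neg : ∀ t → FirstMoverAdvantage t → FirstMoverAdvantage (neg t)
fma-neg t@(node s n f g) a =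
  subst₂ _≤_ (sym (Rv-neg t)) (sym (Lv-neg t)) (neg-mono-≤ (fma-root t a)) ,
  (λ i → fma-neg (g i) (fma-option right t a i)) , (λ i → fma-neg (f i) (fma-option left t a i))

-- The second player answers each move by the mirrored move in the other component.
mutual
  Lv-⊞-neg≤0 : ∀ G → Lv (G ⊞ neg G) ≤ 0ℤ
  Lv-⊞-neg≤0 (node s zero f g) = ≤-reflexive (+-inverseʳ s)
  Lv-⊞-neg≤0 G@(node s (suc n) f g) = Lv-⊞-least G (neg G) 0ℤ zero
    (λ a → ≤-trans (Rv-⊞-lowerʳ (f a) (neg G) a) (Lv-⊞-neg≤0 (f a)))
    (λ b → ≤-trans (Rv-⊞-lowerˡ G (neg (g b)) b) (Lv-⊞-neg≤0 (g b)))

  0≤Rv-⊞-neg : ∀ G → 0ℤ ≤ Rv (G ⊞ neg G)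
  0≤Rv-⊞-neg (node s zero f g) = ≤-reflexive (sym (+-inverseʳ s))
  0≤Rv-⊞-neg G@(node s (suc n) f g) = Rv-⊞-greatest G (neg G) 0ℤ zero
    (λ a → ≤-trans (0≤Rv-⊞-neg (g a)) (Lv-⊞-upperʳ (g a) (neg G) a))
    (λ b → ≤-trans (0≤Rv-⊞-neg (f b)) (Lv-⊞-upperˡ G (neg (f b)) b))

-- Similarity and equivalence of trees

-- Bisimilarity up to reordering and repetition of options: the tree of a sum of positions is only
-- similar, not equal, to the sum of their trees.
infix 4 _~_
data _~_ : Tree → Tree → Set where
  mk~ : ∀ {A B} → (moves A ≡ 0 → stop A ≡ stop B)
      → (∀ p i → ∃ λ j → option p A i ~ option p B j)
      → (∀ p j → ∃ λ i → option p A i ~ option p B j)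
      → A ~ B

~-moves : ∀ {A B} → A ~ B → moves A ≡ 0 → moves B ≡ 0
~-moves {B = node _ zero    _ _} _ _ = refl
~-moves {node _ zero _ _} {node _ (suc _) _ _} (mk~ _ _ bwd) _ with bwd left zero
... | () , _

~-values : ∀ {A B} → A ~ B → (Lv A ≡ Lv B) × (Rv A ≡ Rv B)
~-values {node _ zero _ _} {node _ zero _ _} (mk~ e _ _) = e refl , e refl
~-values {node _ zero _ _} {node _ (suc _) _ _} (mk~ _ _ bwd) with bwd left zero
... | () , _
~-values {node _ (suc _) _ _} {node _ zero _ _} (mk~ _ fwd _) with fwd left zero
... | () , _
~-values {node s (suc n) f g} {node s′ (suc n′) f′ g′} (mk~ _ fwd bwd) =
  ≤-antisym
    (maxF-least n _ _ (λ i → let (j , r) = fwd left i in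
      ≤-trans (≤-reflexive (proj₂ (~-values r))) (maxF-upper n′ (λ j → Rv (f′ j)) j)))
    (maxF-least n′ _ _ (λ j → let (i , r) = bwd left j in
      ≤-trans (≤-reflexive (sym (proj₂ (~-values r)))) (maxF-upper n (λ i → Rv (f i)) i))) ,
  ≤-antisym
    (minF-greatest n′ _ _ (λ j → let (i , r) = bwd right j in
      ≤-trans (minF-lower n (λ i → Lv (g i)) i) (≤-reflexive (proj₁ (~-values r)))))
    (minF-greatest n _ _ (λ i → let (j , r) = fwd right i in
      ≤-trans (minF-lower n′ (λ j → Lv (g′ j)) j) (≤-reflexive (sym (proj₁ (~-values r))))))

~-refl : ∀ A → A ~ A
~-refl A@(node s n f g) = mk~ (λ _ → refl) (λ p i → i , self p i) (λ p i → i , self p i)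
  where
  self : ∀ p i → option p A i ~ option p A i
  self left  i = ~-refl (f i)
  self right i = ~-refl (g i)

~-moves⁻ : ∀ {A B} → A ~ B → moves B ≡ 0 → moves A ≡ 0
~-moves⁻ {node _ zero    _ _} _ _ = refl
~-moves⁻ {node _ (suc _) _ _} {node _ zero _ _} (mk~ _ fwd _) _ with fwd left zero
... | () , _

~-sym : ∀ {A B} → A ~ B → B ~ A
~-sym r@(mk~ e fwd bwd) =
  mk~ (λ z → sym (e (~-moves⁻ r z)))
      (λ p j → let (i , q) = bwd p j in i , ~-sym q)
      (λ p i → let (j , q) = fwd p i in j , ~-sym q)

~-trans : ∀ {A B C} → A ~ B → B ~ C → A ~ C
~-trans r@(mk~ e fwd bwd) (mk~ e′ fwd′ bwd′) =
  mk~ (λ z → trans (e z) (e′ (~-moves r z)))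
      (λ p i → let (j , q) = fwd p i ; (k , q′) = fwd′ p j in k , ~-trans q q′)
      (λ p k → let (j , q′) = bwd′ p k ; (i , q) = bwd p j in i , ~-trans q q′)

~-cong-⊞ : ∀ {A A′ B B′} → A ~ A′ → B ~ B′ → A ⊞ B ~ A′ ⊞ B′
~-cong-⊞ {A@(node _ n _ _)} {A′@(node _ _ _ _)} {B@(node _ _ _ _)} {B′@(node _ _ _ _)}
  r@(mk~ e fwd bwd) r′@(mk~ e′ fwd′ bwd′) =
  mk~ (λ z → cong₂ _⊹_ (e (ℕ.m+n≡0⇒m≡0 n z)) (e′ (ℕ.m+n≡0⇒n≡0 n z)))
      (λ p → option-⊞-elim p A B (λ x → ∃ λ j → x ~ option p (A′ ⊞ B′) j)
        (λ a → let (j , q) = fwd p a in option-⊞-introˡ p A′ B′ (option p A a ⊞ B ~_) j (~-cong-⊞ q r′))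
        (λ b → let (j , q) = fwd′ p b in option-⊞-introʳ p A′ B′ (A ⊞ option p B b ~_) j (~-cong-⊞ r q)))
      (λ p → option-⊞-elim p A′ B′ (λ y → ∃ λ i → option p (A ⊞ B) i ~ y)
        (λ a → let (i , q) = bwd p a in option-⊞-introˡ p A B (_~ option p A′ a ⊞ B′) i (~-cong-⊞ q r′))
        (λ b → let (i , q) = bwd′ p b in option-⊞-introʳ p A B (_~ A′ ⊞ option p B′ b) i (~-cong-⊞ r q)))

mutual
  ~-comm : ∀ G H → G ⊞ H ~ H ⊞ G
  ~-comm G@(node s n f g) H@(node t m h k) =
    mk~ (λ _ → +-comm s t)
      (λ p → option-⊞-elim p G H (λ x → ∃ λ j → x ~ option p (H ⊞ G) j)
         (λ a → option-⊞-introʳ p H G (option p G a ⊞ H ~_) a (~-comm-optionˡ p G H a))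
         (λ b → option-⊞-introˡ p H G (G ⊞ option p H b ~_) b (~-comm-optionʳ p G H b)))
      (λ p → option-⊞-elim p H G (λ y → ∃ λ i → option p (G ⊞ H) i ~ y)
         (λ b → option-⊞-introʳ p G H (_~ option p H b ⊞ G) b (~-comm-optionʳ p G H b))
         (λ a → option-⊞-introˡ p G H (_~ H ⊞ option p G a) a (~-comm-optionˡ p G H a)))

  ~-comm-optionˡ : ∀ p G H a → option p G a ⊞ H ~ H ⊞ option p G a
  ~-comm-optionˡ left  (node s n f g) H a = ~-comm (f a) H
  ~-comm-optionˡ right (node s n f g) H a = ~-comm (g a) H

  ~-comm-optionʳ : ∀ p G H b → G ⊞ option p H b ~ option p H b ⊞ G
  ~-comm-optionʳ left  G (node t m h k) b = ~-comm G (h b)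
  ~-comm-optionʳ right G (node t m h k) b = ~-comm G (k b)

mutual
  ~-assoc : ∀ G H K → (G ⊞ H) ⊞ K ~ G ⊞ (H ⊞ K)
  ~-assoc G@(node s n f g) H@(node t m h k) K@(node u l q r) =
    mk~ (λ _ → +-assoc s t u)
      (λ p → option-⊞-elim p (G ⊞ H) K (λ x → ∃ λ j → x ~ option p (G ⊞ (H ⊞ K)) j)
        (option-⊞-elim p G H (λ x → ∃ λ j → x ⊞ K ~ option p (G ⊞ (H ⊞ K)) j)
          (λ a → option-⊞-introˡ p G (H ⊞ K) ((option p G a ⊞ H) ⊞ K ~_) a (~-assoc-option₁ p G H K a))
          (λ b → let (y , e) = option-⊞-introˡ p H K (λ z → (G ⊞ option p H b) ⊞ K ~ G ⊞ z) b (~-assoc-option₂ p G H K b)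
                 in option-⊞-introʳ p G (H ⊞ K) ((G ⊞ option p H b) ⊞ K ~_) y e))
        (λ c → let (y , e) = option-⊞-introʳ p H K (λ z → (G ⊞ H) ⊞ option p K c ~ G ⊞ z) c (~-assoc-option₃ p G H K c)
               in option-⊞-introʳ p G (H ⊞ K) ((G ⊞ H) ⊞ option p K c ~_) y e))
      (λ p → option-⊞-elim p G (H ⊞ K) (λ y → ∃ λ i → option p ((G ⊞ H) ⊞ K) i ~ y)
        (λ a → let (x , e) = option-⊞-introˡ p G H (λ z → z ⊞ K ~ option p G a ⊞ (H ⊞ K)) a (~-assoc-option₁ p G H K a)
               in option-⊞-introˡ p (G ⊞ H) K (_~ option p G a ⊞ (H ⊞ K)) x e)
        (option-⊞-elim p H K (λ y → ∃ λ i → option p ((G ⊞ H) ⊞ K) i ~ G ⊞ y)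
          (λ b → let (x , e) = option-⊞-introʳ p G H (λ z → z ⊞ K ~ G ⊞ (option p H b ⊞ K)) b (~-assoc-option₂ p G H K b)
                 in option-⊞-introˡ p (G ⊞ H) K (_~ G ⊞ (option p H b ⊞ K)) x e)
          (λ c → option-⊞-introʳ p (G ⊞ H) K (_~ G ⊞ (H ⊞ option p K c)) c (~-assoc-option₃ p G H K c))))

  ~-assoc-option₁ : ∀ p G H K a → (option p G a ⊞ H) ⊞ K ~ option p G a ⊞ (H ⊞ K)
  ~-assoc-option₁ left  (node s n f g) H K a = ~-assoc (f a) H K
  ~-assoc-option₁ right (node s n f g) H K a = ~-assoc (g a) H K

  ~-assoc-option₂ : ∀ p G H K b → (G ⊞ option p H b) ⊞ K ~ G ⊞ (option p H b ⊞ K)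
  ~-assoc-option₂ left  G (node t m h k) K b = ~-assoc G (h b) K
  ~-assoc-option₂ right G (node t m h k) K b = ~-assoc G (k b) K

  ~-assoc-option₃ : ∀ p G H K c → (G ⊞ H) ⊞ option p K c ~ G ⊞ (H ⊞ option p K c)
  ~-assoc-option₃ left  G H (node u l q r) c = ~-assoc G H (q c)
  ~-assoc-option₃ right G H (node u l q r) c = ~-assoc G H (r c)

Lv-⊞-neg : ∀ G → FirstMoverAdvantage G → Lv (G ⊞ neg G) ≡ 0ℤ
Lv-⊞-neg G a = ≤-antisym (Lv-⊞-neg≤0 G)
  (≤-trans (≤-reflexive (sym (trans (cong (Lv G ⊹_) (Rv-neg G)) (+-inverseʳ (Lv G)))))
           (Lv+Rv≤Lv-⊞ G (neg G) a (fma-neg G a)))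

Rv-⊞-neg : ∀ G → FirstMoverAdvantage G → Rv (G ⊞ neg G) ≡ 0ℤ
Rv-⊞-neg G a = ≤-antisym
  (≤-trans (Rv-⊞≤Rv+Lv G (neg G) a (fma-neg G a))
           (≤-reflexive (trans (cong (Rv G ⊹_) (Lv-neg G)) (+-inverseʳ (Rv G)))))
  (0≤Rv-⊞-neg G)

⊞-number : ∀ X k → FirstMoverAdvantage X → Lv X ≡ k → Rv X ≡ k → ∀ W → FirstMoverAdvantage W →
  (Lv (W ⊞ X) ≡ Lv W ⊹ k) × (Rv (W ⊞ X) ≡ Rv W ⊹ k)
⊞-number X k aX eL eR W aW =
  ≤-antisym (≤-trans (Lv-⊞≤Lv+Lv W X aW aX) (≤-reflexive (cong (Lv W ⊹_) eL)))
            (≤-trans (≤-reflexive (cong (Lv W ⊹_) (sym eR))) (Lv+Rv≤Lv-⊞ W X aW aX)) ,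
  ≤-antisym (≤-trans (Rv-⊞≤Rv+Lv W X aW aX) (≤-reflexive (cong (Rv W ⊹_) eL)))
            (≤-trans (≤-reflexive (cong (Rv W ⊹_) (sym eR))) (Rv+Rv≤Rv-⊞ W X aW aX))

⊞-zero : ∀ X → FirstMoverAdvantage X → Lv X ≡ 0ℤ → Rv X ≡ 0ℤ → ∀ W → FirstMoverAdvantage W →
  (Lv (W ⊞ X) ≡ Lv W) × (Rv (W ⊞ X) ≡ Rv W)
⊞-zero X aX eL eR W aW =
  let (l , r) = ⊞-number X 0ℤ aX eL eR W aW in
  trans l (+-identityʳ (Lv W)) , trans r (+-identityʳ (Rv W))

-- Contexts are restricted to trees with the first-mover advantage, which all game trees of positions have.
infix 4 _≈_
_≈_ : Tree → Tree → Set
X ≈ Y = ∀ W → FirstMoverAdvantage W → (Lv (W ⊞ X) ≡ Lv (W ⊞ Y)) × (Rv (W ⊞ X) ≡ Rv (W ⊞ Y))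

≈-refl : ∀ {X} → X ≈ X
≈-refl W _ = refl , refl

≈-sym : ∀ {X Y} → X ≈ Y → Y ≈ X
≈-sym X≈Y W aW = let (l , r) = X≈Y W aW in sym l , sym r

≈-trans : ∀ {X Y Z} → X ≈ Y → Y ≈ Z → X ≈ Z
≈-trans X≈Y Y≈Z W aW =
  let (l , r) = X≈Y W aW ; (l′ , r′) = Y≈Z W aW in trans l l′ , trans r r′

~⇒≈ : ∀ {X Y} → X ~ Y → X ≈ Y
~⇒≈ X~Y W _ = ~-values (~-cong-⊞ (~-refl W) X~Y)

≈-cong-⊞ʳ : ∀ {X Y} K → FirstMoverAdvantage K → X ≈ Y → X ⊞ K ≈ Y ⊞ K
≈-cong-⊞ʳ {X} {Y} K aK X≈Y W aW =
  let (l , r) = X≈Y (W ⊞ K) (fma-⊞ W K aW aK)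
      (lX , rX) = ~-values (regroup X)
      (lY , rY) = ~-values (regroup Y)
  in trans lX (trans l (sym lY)) , trans rX (trans r (sym rY))
  where
  regroup : ∀ Z → W ⊞ (Z ⊞ K) ~ (W ⊞ K) ⊞ Z
  regroup Z = ~-trans (~-cong-⊞ (~-refl W) (~-comm Z K)) (~-sym (~-assoc W K Z))

≈-cong-⊞ : ∀ {X X′ Y Y′} → FirstMoverAdvantage X′ → FirstMoverAdvantage Y →
  X ≈ X′ → Y ≈ Y′ → X ⊞ Y ≈ X′ ⊞ Y′
≈-cong-⊞ {X} {X′} {Y} {Y′} aX′ aY X≈X′ Y≈Y′ =
  ≈-trans (≈-cong-⊞ʳ Y aY X≈X′)
  (≈-trans (~⇒≈ (~-comm X′ Y))
  (≈-trans (≈-cong-⊞ʳ X′ aX′ Y≈Y′) (~⇒≈ (~-comm Y′ X′))))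

≈-leaf : ∀ X k → FirstMoverAdvantage X → Lv X ≡ k → Rv X ≡ k → X ≈ leaf k
≈-leaf X k aX eL eR W aW =
  let (l , r) = ⊞-number X k aX eL eR W aW
      (l′ , r′) = ⊞-number (leaf k) k (fma-leaf k) refl refl W aW
  in trans l (sym l′) , trans r (sym r′)

⊞-interchange : ∀ A B C D → (A ⊞ B) ⊞ (C ⊞ D) ~ (A ⊞ C) ⊞ (B ⊞ D)
⊞-interchange A B C D =
  ~-trans (~-assoc A B (C ⊞ D))
  (~-trans (~-cong-⊞ (~-refl A) (~-sym (~-assoc B C D)))
  (~-trans (~-cong-⊞ (~-refl A) (~-cong-⊞ (~-comm B C) (~-refl D)))
  (~-trans (~-cong-⊞ (~-refl A) (~-assoc C B D))
           (~-sym (~-assoc A C (B ⊞ D))))))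

-- W ⊞ X  and  W ⊞ Y  differ from  (W ⊞ X) ⊞ (Y ⊞ neg Y)  =  (W ⊞ Y) ⊞ (X ⊞ neg Y)  by zeros.
≈-of-difference : ∀ X Y → FirstMoverAdvantage X → FirstMoverAdvantage Y →
  Lv (X ⊞ neg Y) ≡ 0ℤ → Rv (X ⊞ neg Y) ≡ 0ℤ → X ≈ Y
≈-of-difference X Y aX aY eL eR W aW =
  let a-negY = fma-neg Y aY
      (lX , rX) = ⊞-zero (Y ⊞ neg Y) (fma-⊞ Y (neg Y) aY a-negY) (Lv-⊞-neg Y aY) (Rv-⊞-neg Y aY)
                         (W ⊞ X) (fma-⊞ W X aW aX)
      (lY , rY) = ⊞-zero (X ⊞ neg Y) (fma-⊞ X (neg Y) aX a-negY) eL eR (W ⊞ Y) (fma-⊞ W Y aW aY)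
      (l , r) = ~-values (⊞-interchange W X Y (neg Y))
  in trans (sym lX) (trans l lY) , trans (sym rX) (trans r rY)


-- Positions

claim-self : ∀ {n} (σ : Fin n → Owner) v p → claim σ v p v ≡ ownedBy p
claim-self σ v p with v Fin.≟ v
... | yes _ = refl
... | no v≢v = ⊥-elim (v≢v refl)

claim-other : ∀ {n} (σ : Fin n → Owner) v p w → v ≢ w → claim σ v p w ≡ σ w
claim-other σ v p w v≢w with v Fin.≟ w
... | yes v≡w = ⊥-elim (v≢w v≡w)
... | no _ = refl

claim-cong : ∀ {n} {σ τ : Fin n → Owner} v p → (∀ x → σ x ≡ τ x) → ∀ x → claim σ v p x ≡ claim τ v p x
claim-cong v p σ≗τ x with v Fin.≟ x
... | yes _ = refl
... | no _ = σ≗τ x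

claim-comm : ∀ {n} (σ : Fin n → Owner) v p w q → v ≢ w → ∀ x → claim (claim σ v p) w q x ≡ claim (claim σ w q) v p x
claim-comm σ v p w q v≢w x with w Fin.≟ x | v Fin.≟ x
... | yes refl | yes refl = ⊥-elim (v≢w refl)
... | yes refl | no _ = sym (claim-self σ x q)
... | no _ | yes refl = claim-self σ x p
... | no w≢x | no v≢x = trans (claim-other σ v p x v≢x) (sym (claim-other σ w q x w≢x))

claim-rename : ∀ {k l} (σ : Fin l → Owner) {ι : Fin k → Fin l} → (∀ {x y} → ι x ≡ ι y → x ≡ y) →
  ∀ a p x → claim σ (ι a) p (ι x) ≡ claim (σ ∘ ι) a p x
claim-rename σ {ι} ι-injective a p x = by-cases (a Fin.≟ x)
  where
  by-cases : Dec (a ≡ x) → claim σ (ι a) p (ι x) ≡ claim (σ ∘ ι) a p x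
  by-cases (yes refl) = trans (claim-self σ (ι a) p) (sym (claim-self (σ ∘ ι) a p))
  by-cases (no a≢x)   = trans (claim-other σ (ι a) p (ι x) (a≢x ∘ ι-injective)) (sym (claim-other (σ ∘ ι) a p x a≢x))

claimed-≢ : ∀ {n} (σ : Fin n → Owner) v p w → claim σ v p w ≡ free → v ≢ w
claimed-≢ σ v p .v e refl with trans (sym (claim-self σ v p)) e
... | ()

free-before-claim : ∀ {n} (σ : Fin n → Owner) v p w → claim σ v p w ≡ free → σ w ≡ free
free-before-claim σ v p w e = trans (sym (claim-other σ v p w (claimed-≢ σ v p w e))) e

isFree⇒free : ∀ o → isFree o ≡ true → o ≡ free
isFree⇒free free _ = refl

∈-freeVertices⁺ : ∀ {n} (σ : Fin n → Owner) {v} → σ v ≡ free → v ∈ freeVertices σ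
∈-freeVertices⁺ σ {v} e = ∈-filter⁺ (λ v → isFree (σ v) Bool.≟ true) (∈-allFin v) (cong isFree e)

∈-freeVertices⁻ : ∀ {n} (σ : Fin n → Owner) {v} → v ∈ freeVertices σ → σ v ≡ free
∈-freeVertices⁻ {n} σ {v} v∈ =
  isFree⇒free (σ v) (proj₂ (∈-filter⁻ (λ v → isFree (σ v) Bool.≟ true) {xs = allFin n} v∈))

freeVertices-cong : ∀ {n} {σ τ : Fin n → Owner} → (∀ x → σ x ≡ τ x) → freeVertices σ ≡ freeVertices τ
freeVertices-cong {n} {σ} {τ} σ≗τ = go n (λ i → i)
  where
  go : ∀ m (g : Fin m → Fin n) →
    filter (λ v → isFree (σ v) Bool.≟ true) (tabulate g) ≡ filter (λ v → isFree (τ v) Bool.≟ true) (tabulate g)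
  go zero    g = refl
  go (suc m) g with isFree (σ (g zero)) | isFree (τ (g zero)) | cong isFree (σ≗τ (g zero))
  ... | true  | .true  | refl = cong (g zero ∷_) (go m (λ i → g (suc i)))
  ... | false | .false | refl = go m (λ i → g (suc i))

#free : ∀ {n} → (Fin n → Owner) → ℕ
#free σ = length (freeVertices σ)

countTrue : (n : ℕ) → (Fin n → Bool) → ℕ
countTrue zero    b = 0
countTrue (suc n) b = (if b zero then 1 else 0) + countTrue n (λ i → b (suc i))

countTrue-cong : ∀ n {b b′ : Fin n → Bool} → (∀ i → b i ≡ b′ i) → countTrue n b ≡ countTrue n b′
countTrue-cong zero    _ = refl
countTrue-cong (suc n) h = cong₂ _+_ (cong (if_then 1 else 0) (h zero)) (countTrue-cong n (λ i → h (suc i)))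

countTrue-drop : ∀ n (b b′ : Fin n → Bool) v → b v ≡ true → b′ v ≡ false → (∀ w → v ≢ w → b′ w ≡ b w) →
  countTrue n b ≡ suc (countTrue n b′)
countTrue-drop (suc n) b b′ zero e e′ h rewrite e | e′ =
  cong suc (countTrue-cong n (λ i → sym (h (suc i) (λ ()))))
countTrue-drop (suc n) b b′ (suc v) e e′ h =
  trans (cong₂ _+_ (cong (if_then 1 else 0) (sym (h zero (λ ()))))
                   (countTrue-drop n _ _ v e e′ (λ w v≢w → h (suc w) (v≢w ∘ Fin-suc-injective))))
        (ℕ.+-suc (if b′ zero then 1 else 0) _)

#free-countTrue : ∀ {n} (σ : Fin n → Owner) → #free σ ≡ countTrue n (λ i → isFree (σ i))
#free-countTrue {n} σ = go n (λ i → i)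
  where
  go : ∀ m (g : Fin m → Fin n) →
    length (filter (λ v → isFree (σ v) Bool.≟ true) (tabulate g)) ≡ countTrue m (λ i → isFree (σ (g i)))
  go zero    g = refl
  go (suc m) g with isFree (σ (g zero))
  ... | true  = cong suc (go m (λ i → g (suc i)))
  ... | false = go m (λ i → g (suc i))

#free-cong : ∀ {n} {σ τ : Fin n → Owner} → (∀ x → σ x ≡ τ x) → #free σ ≡ #free τ
#free-cong {n} {σ} {τ} σ≗τ =
  trans (#free-countTrue σ) (trans (countTrue-cong n (λ i → cong isFree (σ≗τ i))) (sym (#free-countTrue τ)))

#free-claim : ∀ {n} (σ : Fin n → Owner) v p → σ v ≡ free → #free σ ≡ suc (#free (claim σ v p))
#free-claim {n} σ v p e =
  trans (#free-countTrue σ)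
 (trans (countTrue-drop n _ _ v (cong isFree e) (cong isFree (claim-self σ v p))
                        (λ w v≢w → cong isFree (claim-other σ v p w v≢w)))
        (cong suc (sym (#free-countTrue (claim σ v p)))))

#free-allFree : ∀ n → #free {n} (λ _ → free) ≡ n
#free-allFree n = trans (#free-countTrue {n} (λ _ → free)) (go n)
  where
  go : ∀ n → countTrue n (λ _ → true) ≡ n
  go zero    = refl
  go (suc n) = cong suc (go n)

∉-#free-zero : ∀ {n} (σ : Fin n → Owner) {v} → 0 ≡ #free σ → v ∈ freeVertices σ → ⊥
∉-#free-zero σ e v∈ with freeVertices σ
∉-#free-zero σ () (here _)  | _ ∷ _
∉-#free-zero σ () (there _) | _ ∷ _

module _ {A : Set} (f : A → ℤ) where

  foldr-⊔-≥-init : ∀ z vs → z ≤ foldr (λ w acc → f w ⊔ acc) z vs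
  foldr-⊔-≥-init z []       = ≤-refl
  foldr-⊔-≥-init z (w ∷ vs) = ≤-trans (foldr-⊔-≥-init z vs) (i≤j⊔i _ _)

  foldr-⊔-upper : ∀ z vs {x} → x ∈ vs → f x ≤ foldr (λ w acc → f w ⊔ acc) z vs
  foldr-⊔-upper z (w ∷ vs) (here refl) = i≤i⊔j _ _
  foldr-⊔-upper z (w ∷ vs) (there x∈) = ≤-trans (foldr-⊔-upper z vs x∈) (i≤j⊔i _ _)

  foldr-⊔-least : ∀ z vs c → z ≤ c → (∀ {x} → x ∈ vs → f x ≤ c) → foldr (λ w acc → f w ⊔ acc) z vs ≤ c
  foldr-⊔-least z []       c z≤c h = z≤c
  foldr-⊔-least z (w ∷ vs) c z≤c h = ⊔-lub (h (here refl)) (foldr-⊔-least z vs c z≤c (h ∘ there))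

  foldr-⊓-≤-init : ∀ z vs → foldr (λ w acc → f w ⊓ acc) z vs ≤ z
  foldr-⊓-≤-init z []       = ≤-refl
  foldr-⊓-≤-init z (w ∷ vs) = ≤-trans (i⊓j≤j _ _) (foldr-⊓-≤-init z vs)

  foldr-⊓-lower : ∀ z vs {x} → x ∈ vs → foldr (λ w acc → f w ⊓ acc) z vs ≤ f x
  foldr-⊓-lower z (w ∷ vs) (here refl) = i⊓j≤i _ _
  foldr-⊓-lower z (w ∷ vs) (there x∈) = ≤-trans (i⊓j≤j _ _) (foldr-⊓-lower z vs x∈)

  foldr-⊓-greatest : ∀ z vs c → c ≤ z → (∀ {x} → x ∈ vs → c ≤ f x) → c ≤ foldr (λ w acc → f w ⊓ acc) z vs
  foldr-⊓-greatest z []       c c≤z h = c≤z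
  foldr-⊓-greatest z (w ∷ vs) c c≤z h = ⊓-glb (h (here refl)) (foldr-⊓-greatest z vs c c≤z (h ∘ there))

  best-left-upper : ∀ xs d {x} → x ∈ xs → f x ≤ best left xs f d
  best-left-upper (v ∷ vs) d (here refl) = foldr-⊔-≥-init (f v) vs
  best-left-upper (v ∷ vs) d (there x∈) = foldr-⊔-upper (f v) vs x∈

  best-left-least : ∀ xs d c → (xs ≡ [] → d ≤ c) → (∀ {x} → x ∈ xs → f x ≤ c) → best left xs f d ≤ c
  best-left-least []       d c hd h = hd refl
  best-left-least (v ∷ vs) d c hd h = foldr-⊔-least (f v) vs c (h (here refl)) (h ∘ there)

  best-right-lower : ∀ xs d {x} → x ∈ xs → best right xs f d ≤ f x
  best-right-lower (v ∷ vs) d (here refl) = foldr-⊓-≤-init (f v) vs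
  best-right-lower (v ∷ vs) d (there x∈) = foldr-⊓-lower (f v) vs x∈

  best-right-greatest : ∀ xs d c → (xs ≡ [] → c ≤ d) → (∀ {x} → x ∈ xs → c ≤ f x) → c ≤ best right xs f d
  best-right-greatest []       d c hd h = hd refl
  best-right-greatest (v ∷ vs) d c hd h = foldr-⊓-greatest (f v) vs c (h (here refl)) (h ∘ there)

best-cong : ∀ {A : Set} p xs {f f′ : A → ℤ} {d d′} → (∀ x → f x ≡ f′ x) → d ≡ d′ → best p xs f d ≡ best p xs f′ d′
best-cong p []       f≗f′ d≡d′ = d≡d′
best-cong p (v ∷ vs) {f} {f′} f≗f′ _ = go vs
  where
  go : ∀ vs → foldr (λ w acc → opt p (f w) acc) (f v) vs ≡ foldr (λ w acc → opt p (f′ w) acc) (f′ v) vs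
  go []       = f≗f′ v
  go (w ∷ ws) = cong₂ (opt p) (f≗f′ w) (go ws)

edgeValue : ∀ {k} → (Fin k → Owner) → Colour × List (Fin k) → ℤ
edgeValue σ e = edgePoint σ left e ⊹ - edgePoint σ right e

edgeSum : ∀ {k} → (Fin k → Owner) → ℤ → List (Colour × List (Fin k)) → ℤ
edgeSum σ = foldr (λ e acc → edgeValue σ e ⊹ acc)

_⊑_ : ∀ {n} → (Fin n → Owner) → (Fin n → Owner) → Set
σ ⊑ τ = ∀ x → (ownedByP left (σ x) ≡ true → ownedByP left (τ x) ≡ true)
            × (ownedByP right (τ x) ≡ true → ownedByP right (σ x) ≡ true)

allB-mono : ∀ {A : Set} (p q : A → Bool) xs → (∀ x → p x ≡ true → q x ≡ true) → allB p xs ≡ true → allB q xs ≡ true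
allB-mono p q []       h e = refl
allB-mono p q (x ∷ xs) h e with p x | q x | h x
... | true  | true  | _  = allB-mono p q xs h e
... | true  | false | hx = hx refl

indicator-mono : ∀ b c → (b ≡ true → c ≡ true) → (if b then 1ℤ else 0ℤ) ≤ (if c then 1ℤ else 0ℤ)
indicator-mono true  true  h = ≤-refl
indicator-mono true  false h with h refl
... | ()
indicator-mono false true  h = +≤+ z≤n
indicator-mono false false h = ≤-refl

edgePoint-mono : ∀ {n} {σ τ : Fin n → Owner} p → (∀ x → ownedByP p (σ x) ≡ true → ownedByP p (τ x) ≡ true) →
  ∀ e → edgePoint σ p e ≤ edgePoint τ p e
edgePoint-mono {σ = σ} {τ} p h (c , vs) = indicator-mono _ _ (mono (countsFor p c))
  where
  mono : ∀ b → b ∧ allB (λ v → ownedByP p (σ v)) vs ≡ true → b ∧ allB (λ v → ownedByP p (τ v)) vs ≡ true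
  mono true = allB-mono _ _ vs h

score-mono : ∀ G {σ τ : Fin (size G) → Owner} → σ ⊑ τ → score G σ ≤ score G τ
score-mono G {σ} {τ} σ⊑τ = go (edges G)
  where
  go : ∀ es → edgeSum σ (offset G) es ≤ edgeSum τ (offset G) es
  go []       = ≤-refl
  go (e ∷ es) = +-mono-≤ (+-mono-≤ (edgePoint-mono left (proj₁ ∘ σ⊑τ) e)
                                   (neg-mono-≤ (edgePoint-mono right (proj₂ ∘ σ⊑τ) e))) (go es)

score-cong : ∀ G {σ τ : Fin (size G) → Owner} → (∀ x → σ x ≡ τ x) → score G σ ≡ score G τ
score-cong G {σ} {τ} σ≗τ = ≤-antisym (score-mono G (⊑-of σ≗τ)) (score-mono G (⊑-of (sym ∘ σ≗τ)))
  where
  ⊑-of : ∀ {σ τ : Fin (size G) → Owner} → (∀ x → σ x ≡ τ x) → σ ⊑ τ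
  ⊑-of σ≗τ x = subst (λ o → ownedByP left o ≡ true) (σ≗τ x) , subst (λ o → ownedByP right o ≡ true) (sym (σ≗τ x))

score-claim-right≤left : ∀ G (σ : Fin (size G) → Owner) v → score G (claim σ v right) ≤ score G (claim σ v left)
score-claim-right≤left G σ v = score-mono G ⊑
  where
  ⊑ : claim σ v right ⊑ claim σ v left
  ⊑ x with v Fin.≟ x
  ... | yes _ = (λ ()) , (λ ())
  ... | no _  = (λ e → e) , (λ e → e)

value-cong : ∀ G k p {σ τ : Fin (size G) → Owner} → (∀ x → σ x ≡ τ x) → value G k p σ ≡ value G k p τ
value-cong G zero    p σ≗τ = score-cong G σ≗τ
value-cong G (suc k) p {σ} {τ} σ≗τ =
  trans (cong (λ xs → best p xs (λ v → value G k (opponent p) (claim σ v p)) (score G σ)) (freeVertices-cong σ≗τ))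
        (best-cong p (freeVertices τ) (λ v → value-cong G k (opponent p) (claim-cong v p σ≗τ)) (score-cong G σ≗τ))

-- Strategy stealing: owning a vertex already is worth at least as much to Left as being able to claim
-- it later, because the score is monotone in the claimed sets.
mutual
  value-right-gift : ∀ G k (σ : Fin (size G) → Owner) v → suc k ≡ #free σ → σ v ≡ free →
    value G (suc k) right σ ≤ value G k right (claim σ v left)
  value-right-gift G zero σ v _ v-free =
    ≤-trans (best-right-lower _ (freeVertices σ) _ (∈-freeVertices⁺ σ v-free)) (score-claim-right≤left G σ v)
  value-right-gift G (suc k) σ v k≡ v-free =
    best-right-greatest _ (freeVertices σ′) _ _ (λ e → ⊥-elim (nonempty e)) λ {w} w∈ →
      let w-free′ = ∈-freeVertices⁻ σ′ w∈
          v≢w = claimed-≢ σ v left w w-free′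
          w-free = free-before-claim σ v left w w-free′
      in ≤-trans (best-right-lower _ (freeVertices σ) _ (∈-freeVertices⁺ σ w-free))
        (≤-trans (value-left-gift G k (claim σ w right) v
                    (ℕ.suc-injective (trans k≡ (#free-claim σ w right w-free)))
                    (trans (claim-other σ w right v (v≢w ∘ sym)) v-free))
                 (≤-reflexive (value-cong G k left (claim-comm σ w right v left (v≢w ∘ sym)))))
    where
    σ′ = claim σ v left
    nonempty : freeVertices σ′ ≢ []
    nonempty e = ℕ.1+n≢0 (trans (ℕ.suc-injective (trans k≡ (#free-claim σ v left v-free))) (cong length e))

  value-left-gift : ∀ G k (σ : Fin (size G) → Owner) v → suc k ≡ #free σ → σ v ≡ free →
    value G (suc k) left σ ≤ value G k left (claim σ v left)
  value-left-gift G k σ v k≡ v-free =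
    best-left-least _ (freeVertices σ) _ _ (λ e → ⊥-elim (ℕ.1+n≢0 (trans k≡ (cong length e))))
      λ {w} w∈ → answer w (∈-freeVertices⁻ σ w∈)
    where
    σ′ = claim σ v left
    k≡′ : k ≡ #free σ′
    k≡′ = ℕ.suc-injective (trans k≡ (#free-claim σ v left v-free))
    answer : ∀ w → σ w ≡ free → value G k right (claim σ w left) ≤ value G k left σ′
    answer w w-free with v Fin.≟ w
    ... | yes refl = value-right≤left G k σ′ k≡′
    ... | no v≢w = answer′ k k≡′ (∈-freeVertices⁺ σ′ (trans (claim-other σ v left w v≢w) w-free))
      where
      answer′ : ∀ k → k ≡ #free σ′ → w ∈ freeVertices σ′ → value G k right (claim σ w left) ≤ value G k left σ′
      answer′ zero    k≡0 w∈ = ⊥-elim (∉-#free-zero σ′ k≡0 w∈)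
      answer′ (suc j) j≡  w∈ =
        ≤-trans (value-right-gift G j (claim σ w left) v
                   (ℕ.suc-injective (trans (trans (cong suc j≡) (sym (#free-claim σ v left v-free)))
                                           (#free-claim σ w left w-free)))
                   (trans (claim-other σ w left v (v≢w ∘ sym)) v-free))
       (≤-trans (≤-reflexive (value-cong G j right (claim-comm σ w left v left (v≢w ∘ sym))))
                (best-left-upper _ (freeVertices σ′) _ w∈))

  value-right≤left : ∀ G k (σ : Fin (size G) → Owner) → k ≡ #free σ → value G k right σ ≤ value G k left σ
  value-right≤left G zero    σ _  = ≤-refl
  value-right≤left G (suc k) σ k≡ =
    let (v , v∈) = some-member (freeVertices σ) k≡ in
    ≤-trans (value-right-gift G k σ v k≡ (∈-freeVertices⁻ σ v∈)) (best-left-upper _ (freeVertices σ) _ v∈)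
    where
    some-member : ∀ {A : Set} (xs : List A) {k} → suc k ≡ length xs → ∃ λ v → v ∈ xs
    some-member (x ∷ _) _ = x , here refl

-- The game tree of a position

-- The fuel k is kept equal to the number of free vertices, so play runs until the board is full.
tree : (G : Game) → ℕ → (Fin (size G) → Owner) → Tree
tree G zero    σ = leaf (score G σ)
tree G (suc k) σ = node (score G σ) (length (freeVertices σ))
  (λ i → tree G k (claim σ (lookup (freeVertices σ) i) left))
  (λ i → tree G k (claim σ (lookup (freeVertices σ) i) right))

Lv-listed : ∀ {A : Set} s (xs : List A) (F F′ : A → Tree) →
  Lv (node s (length xs) (λ i → F (lookup xs i)) (λ i → F′ (lookup xs i))) ≡ best left xs (λ v → Rv (F v)) s
Lv-listed s []         F F′ = refl
Lv-listed s xs@(_ ∷ _) F F′ = ≤-antisym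
  (Lv-least t _ zero (λ i → best-left-upper _ xs s (∈-lookup i)))
  (best-left-least _ xs s _ (λ ()) (λ x∈ → subst (λ y → Rv (F y) ≤ Lv t) (sym (lookup-index x∈)) (Lv-upper t (index x∈))))
  where t = node s (length xs) (λ i → F (lookup xs i)) (λ i → F′ (lookup xs i))

Rv-listed : ∀ {A : Set} s (xs : List A) (F F′ : A → Tree) →
  Rv (node s (length xs) (λ i → F (lookup xs i)) (λ i → F′ (lookup xs i))) ≡ best right xs (λ v → Lv (F′ v)) s
Rv-listed s []         F F′ = refl
Rv-listed s xs@(_ ∷ _) F F′ = ≤-antisym
  (best-right-greatest _ xs s _ (λ ()) (λ x∈ → subst (λ y → Rv t ≤ Lv (F′ y)) (sym (lookup-index x∈)) (Rv-lower t (index x∈))))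
  (Rv-greatest t _ zero (λ i → best-right-lower _ xs s (∈-lookup i)))
  where t = node s (length xs) (λ i → F (lookup xs i)) (λ i → F′ (lookup xs i))

tree-values : ∀ G k σ → (Lv (tree G k σ) ≡ value G k left σ) × (Rv (tree G k σ) ≡ value G k right σ)
tree-values G zero    σ = refl , refl
tree-values G (suc k) σ =
  trans (Lv-listed (score G σ) (freeVertices σ) (λ v → tree G k (claim σ v left)) (λ v → tree G k (claim σ v right)))
        (best-cong left (freeVertices σ) (λ v → proj₂ (tree-values G k (claim σ v left))) refl) ,
  trans (Rv-listed (score G σ) (freeVertices σ) (λ v → tree G k (claim σ v left)) (λ v → tree G k (claim σ v right)))
        (best-cong right (freeVertices σ) (λ v → proj₁ (tree-values G k (claim σ v right))) refl)

stop-tree : ∀ G k σ → stop (tree G k σ) ≡ score G σ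
stop-tree G zero    σ = refl
stop-tree G (suc k) σ = refl

tree-option : ∀ G k σ p i → ∃ λ v → v ∈ freeVertices σ × option p (tree G k σ) i ≡ tree G (pred k) (claim σ v p)
tree-option G (suc k) σ left  i = lookup (freeVertices σ) i , ∈-lookup i , refl
tree-option G (suc k) σ right i = lookup (freeVertices σ) i , ∈-lookup i , refl

tree-option-of : ∀ G k σ p {v} → k ≡ #free σ → v ∈ freeVertices σ →
  ∃ λ i → option p (tree G k σ) i ≡ tree G (pred k) (claim σ v p)
tree-option-of G zero    σ p       k≡ v∈ = ⊥-elim (∉-#free-zero σ k≡ v∈)
tree-option-of G (suc k) σ left  _ v∈ = index v∈ , cong (λ y → tree G k (claim σ y left)) (sym (lookup-index v∈))
tree-option-of G (suc k) σ right _ v∈ = index v∈ , cong (λ y → tree G k (claim σ y right)) (sym (lookup-index v∈))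

tree-~ : ∀ G k σ B → k ≡ #free σ → score G σ ≡ stop B
  → (∀ p {v} → v ∈ freeVertices σ → ∃ λ j → tree G (pred k) (claim σ v p) ~ option p B j)
  → (∀ p j → ∃ λ v → v ∈ freeVertices σ × tree G (pred k) (claim σ v p) ~ option p B j)
  → tree G k σ ~ B
tree-~ G k σ B k≡ stops fwd bwd =
  mk~ (λ _ → trans (stop-tree G k σ) stops)
    (λ p i → let (v , v∈ , e) = tree-option G k σ p i ; (j , r) = fwd p v∈ in j , subst (_~ option p B j) (sym e) r)
    (λ p j → let (v , v∈ , r) = bwd p j ; (i , e) = tree-option-of G k σ p k≡ v∈ in i , subst (_~ option p B j) (sym e) r)

fma-tree : ∀ G k σ → k ≡ #free σ → FirstMoverAdvantage (tree G k σ)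
fma-tree G zero    σ _  = fma-leaf (score G σ)
fma-tree G (suc k) σ k≡ =
  subst₂ _≤_ (sym (proj₂ (tree-values G (suc k) σ))) (sym (proj₁ (tree-values G (suc k) σ))) (value-right≤left G (suc k) σ k≡) ,
  (λ i → fma-tree G k _ (after i left)) , (λ i → fma-tree G k _ (after i right))
  where
  after : ∀ i p → k ≡ #free (claim σ (lookup (freeVertices σ) i) p)
  after i p = ℕ.suc-injective (trans k≡ (#free-claim σ _ p (∈-freeVertices⁻ σ (∈-lookup i))))

tree-fuel : ∀ G {k k′} σ → k ≡ k′ → tree G k σ ~ tree G k′ σ
tree-fuel G σ refl = ~-refl _

tree-cong : ∀ G k {σ τ} → k ≡ #free σ → (∀ x → σ x ≡ τ x) → tree G k σ ~ tree G k τ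
tree-cong G zero {σ} {τ} k≡ σ≗τ =
  tree-~ G zero σ (tree G zero τ) k≡ (score-cong G σ≗τ) (λ p v∈ → ⊥-elim (∉-#free-zero σ k≡ v∈)) (λ p ())
tree-cong G (suc k) {σ} {τ} k≡ σ≗τ =
  tree-~ G (suc k) σ (tree G (suc k) τ) k≡ (score-cong G σ≗τ)
    (λ p {v} v∈ →
      let (i , e) = tree-option-of G (suc k) τ p (trans k≡ (#free-cong σ≗τ))
                                   (∈-freeVertices⁺ τ (trans (sym (σ≗τ v)) (∈-freeVertices⁻ σ v∈)))
      in i , subst (tree G k (claim σ v p) ~_) (sym e) (claimed p (∈-freeVertices⁻ σ v∈)))
    (λ p j →
      let (v , v∈ , e) = tree-option G (suc k) τ p j
          v-free = trans (σ≗τ v) (∈-freeVertices⁻ τ v∈)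
      in v , ∈-freeVertices⁺ σ v-free , subst (tree G k (claim σ v p) ~_) (sym e) (claimed p v-free))
  where
  claimed : ∀ p {v} → σ v ≡ free → tree G k (claim σ v p) ~ tree G k (claim τ v p)
  claimed p {v} v-free = tree-cong G k (ℕ.suc-injective (trans k≡ (#free-claim σ v p v-free))) (claim-cong v p σ≗τ)

↑ˡ≢↑ʳ : ∀ {m n} (a : Fin m) (b : Fin n) → a ↑ˡ n ≢ m ↑ʳ b
↑ˡ≢↑ʳ {m} {n} a b e with trans (sym (splitAt-↑ˡ m a n)) (trans (cong (splitAt m) e) (splitAt-↑ʳ m n b))
... | ()

↑ˡ-or-↑ʳ : ∀ m n (v : Fin (m + n)) → (∃ λ a → v ≡ a ↑ˡ n) ⊎ (∃ λ b → v ≡ m ↑ʳ b)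
↑ˡ-or-↑ʳ m n v with splitAt m v in eq
... | inj₁ a = inj₁ (a , sym (splitAt⁻¹-↑ˡ eq))
... | inj₂ b = inj₂ (b , sym (splitAt⁻¹-↑ʳ eq))

module Split (m n : ℕ) where

  restrictˡ : (Fin (m + n) → Owner) → Fin m → Owner
  restrictˡ σ a = σ (a ↑ˡ n)

  restrictʳ : (Fin (m + n) → Owner) → Fin n → Owner
  restrictʳ σ b = σ (m ↑ʳ b)

  restrictˡ-claimˡ : ∀ σ a p x → restrictˡ (claim σ (a ↑ˡ n) p) x ≡ claim (restrictˡ σ) a p x
  restrictˡ-claimˡ σ a p x = claim-rename σ (λ {x} {y} → ↑ˡ-injective n x y) a p x

  restrictʳ-claimˡ : ∀ σ a p y → restrictʳ (claim σ (a ↑ˡ n) p) y ≡ restrictʳ σ y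
  restrictʳ-claimˡ σ a p y = claim-other σ (a ↑ˡ n) p (m ↑ʳ y) (↑ˡ≢↑ʳ a y)

  restrictˡ-claimʳ : ∀ σ b p x → restrictˡ (claim σ (m ↑ʳ b) p) x ≡ restrictˡ σ x
  restrictˡ-claimʳ σ b p x = claim-other σ (m ↑ʳ b) p (x ↑ˡ n) (↑ˡ≢↑ʳ x b ∘ sym)

  restrictʳ-claimʳ : ∀ σ b p y → restrictʳ (claim σ (m ↑ʳ b) p) y ≡ claim (restrictʳ σ) b p y
  restrictʳ-claimʳ σ b p y = claim-rename σ (λ {x} {y} → ↑ʳ-injective m x y) b p y

allB-map : ∀ {A C : Set} (p : C → Bool) (f : A → C) xs → allB p (map f xs) ≡ allB (p ∘ f) xs
allB-map p f []       = refl
allB-map p f (x ∷ xs) = cong (p (f x) ∧_) (allB-map p f xs)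

edgeValue-rename : ∀ {k l} (σ : Fin l → Owner) (ι : Fin k → Fin l) c vs →
  edgeValue σ (c , map ι vs) ≡ edgeValue (σ ∘ ι) (c , vs)
edgeValue-rename σ ι c vs = cong₂ (λ a b → a ⊹ - b) (points left) (points right)
  where points = λ p → cong (λ b → if countsFor p c ∧ b then 1ℤ else 0ℤ) (allB-map (ownedByP p ∘ σ) ι vs)

edgeSum-map : ∀ {k l} {σ : Fin l → Owner} {τ : Fin k → Owner} f z es →
  (∀ e → edgeValue σ (f e) ≡ edgeValue τ e) → edgeSum σ z (map f es) ≡ edgeSum τ z es
edgeSum-map f z []       h = refl
edgeSum-map f z (e ∷ es) h = cong₂ _⊹_ (h e) (edgeSum-map f z es h)

edgeSum-+ : ∀ {k} (σ : Fin k → Owner) a b es → edgeSum σ (a ⊹ b) es ≡ edgeSum σ a es ⊹ b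
edgeSum-+ σ a b es = sym (foldr-fusion (_⊹ b) a (λ e acc → +-assoc (edgeValue σ e) acc b) es)

+-edgeSum : ∀ {k} (σ : Fin k → Owner) a b es → edgeSum σ (a ⊹ b) es ≡ a ⊹ edgeSum σ b es
+-edgeSum σ a b es = sym (foldr-fusion (a ⊹_) b (λ e acc → x∙yz≈y∙xz a (edgeValue σ e) acc) es)

module _ (Z X : Game) where
  open Split (size Z) (size X)

  score-⊕ : ∀ σ → score (Z ⊕ X) σ ≡ score Z (restrictˡ σ) ⊹ score X (restrictʳ σ)
  score-⊕ σ = begin
    score (Z ⊕ X) σ
      ≡⟨ foldr-++ _ _ (map _ (edges Z)) (map _ (edges X)) ⟩
    edgeSum σ (edgeSum σ (offset Z ⊹ offset X) (map _ (edges X))) (map _ (edges Z))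
      ≡⟨ edgeSum-map _ _ (edges Z) (λ { (c , vs) → edgeValue-rename σ _ c vs }) ⟩
    edgeSum (restrictˡ σ) (edgeSum σ (offset Z ⊹ offset X) (map _ (edges X))) (edges Z)
      ≡⟨ cong (λ z → edgeSum (restrictˡ σ) z (edges Z)) (edgeSum-map _ _ (edges X) (λ { (c , vs) → edgeValue-rename σ _ c vs })) ⟩
    edgeSum (restrictˡ σ) (edgeSum (restrictʳ σ) (offset Z ⊹ offset X) (edges X)) (edges Z)
      ≡⟨ cong (λ z → edgeSum (restrictˡ σ) z (edges Z)) (+-edgeSum (restrictʳ σ) (offset Z) (offset X) (edges X)) ⟩
    edgeSum (restrictˡ σ) (offset Z ⊹ score X (restrictʳ σ)) (edges Z)
      ≡⟨ edgeSum-+ (restrictˡ σ) (offset Z) _ (edges Z) ⟩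
    score Z (restrictˡ σ) ⊹ score X (restrictʳ σ) ∎
    where open ≡-Reasoning

  treeˡ treeʳ : (Fin (size Z + size X) → Owner) → Tree
  treeˡ σ = tree Z (#free (restrictˡ σ)) (restrictˡ σ)
  treeʳ σ = tree X (#free (restrictʳ σ)) (restrictʳ σ)

  stop-⊕ : ∀ σ → score (Z ⊕ X) σ ≡ stop (treeˡ σ ⊞ treeʳ σ)
  stop-⊕ σ = trans (score-⊕ σ) (sym (trans (stop-⊞ (treeˡ σ) (treeʳ σ))
                                             (cong₂ _⊹_ (stop-tree Z (#free (restrictˡ σ)) (restrictˡ σ)) (stop-tree X (#free (restrictʳ σ)) (restrictʳ σ)))))

  private
    reached : (Fin (size Z + size X) → Owner) → ℕ → Player → Tree → Set
    reached σ k p t = ∃ λ v → v ∈ freeVertices σ × tree (Z ⊕ X) k (claim σ v p) ~ t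

  mutual
    tree-⊕ : ∀ k σ → k ≡ #free σ → tree (Z ⊕ X) k σ ~ treeˡ σ ⊞ treeʳ σ
    tree-⊕ zero σ k≡ =
      tree-~ (Z ⊕ X) zero σ (treeˡ σ ⊞ treeʳ σ) k≡ (stop-⊕ σ)
        (λ p v∈ → ⊥-elim (∉-#free-zero σ k≡ v∈))
        (λ p → option-⊞-elim p (treeˡ σ) (treeʳ σ) (reached σ 0 p)
          (λ i → let (a , a∈ , _) = tree-option Z (#free (restrictˡ σ)) (restrictˡ σ) p i in
                 ⊥-elim (∉-#free-zero σ k≡ (∈-freeVertices⁺ σ (∈-freeVertices⁻ (restrictˡ σ) a∈))))
          (λ i → let (b , b∈ , _) = tree-option X (#free (restrictʳ σ)) (restrictʳ σ) p i in
                 ⊥-elim (∉-#free-zero σ k≡ (∈-freeVertices⁺ σ (∈-freeVertices⁻ (restrictʳ σ) b∈)))))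
    tree-⊕ (suc k) σ k≡ =
      tree-~ (Z ⊕ X) (suc k) σ (treeˡ σ ⊞ treeʳ σ) k≡ (stop-⊕ σ)
        (λ p {v} v∈ → forward p (∈-freeVertices⁻ σ v∈) (↑ˡ-or-↑ʳ (size Z) (size X) v))
        (λ p → option-⊞-elim p (treeˡ σ) (treeʳ σ) (reached σ k p)
          (λ i → let (a , a∈ , e) = tree-option Z (#free (restrictˡ σ)) (restrictˡ σ) p i
                     a-free = ∈-freeVertices⁻ (restrictˡ σ) a∈
                 in a ↑ˡ size X , ∈-freeVertices⁺ σ a-free ,
                    subst (λ t → tree (Z ⊕ X) k (claim σ (a ↑ˡ size X) p) ~ t ⊞ treeʳ σ) (sym e) (claim-stepˡ k σ k≡ p a a-free))
          (λ i → let (b , b∈ , e) = tree-option X (#free (restrictʳ σ)) (restrictʳ σ) p i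
                     b-free = ∈-freeVertices⁻ (restrictʳ σ) b∈
                 in size Z ↑ʳ b , ∈-freeVertices⁺ σ b-free ,
                    subst (λ t → tree (Z ⊕ X) k (claim σ (size Z ↑ʳ b) p) ~ treeˡ σ ⊞ t) (sym e) (claim-stepʳ k σ k≡ p b b-free)))
      where
      forward : ∀ p {v} → σ v ≡ free → _ → ∃ λ j → tree (Z ⊕ X) k (claim σ v p) ~ option p (treeˡ σ ⊞ treeʳ σ) j
      forward p v-free (inj₁ (a , refl)) =
        let (i , e) = tree-option-of Z (#free (restrictˡ σ)) (restrictˡ σ) p refl (∈-freeVertices⁺ (restrictˡ σ) v-free) in
        option-⊞-introˡ p (treeˡ σ) (treeʳ σ) (tree (Z ⊕ X) k (claim σ (a ↑ˡ size X) p) ~_) i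
          (subst (λ t → _ ~ t ⊞ treeʳ σ) (sym e) (claim-stepˡ k σ k≡ p a v-free))
      forward p v-free (inj₂ (b , refl)) =
        let (i , e) = tree-option-of X (#free (restrictʳ σ)) (restrictʳ σ) p refl (∈-freeVertices⁺ (restrictʳ σ) v-free) in
        option-⊞-introʳ p (treeˡ σ) (treeʳ σ) (tree (Z ⊕ X) k (claim σ (size Z ↑ʳ b) p) ~_) i
          (subst (λ t → _ ~ treeˡ σ ⊞ t) (sym e) (claim-stepʳ k σ k≡ p b v-free))

    claim-stepˡ : ∀ k σ → suc k ≡ #free σ → ∀ p a → σ (a ↑ˡ size X) ≡ free →
      tree (Z ⊕ X) k (claim σ (a ↑ˡ size X) p) ~ tree Z (pred (#free (restrictˡ σ))) (claim (restrictˡ σ) a p) ⊞ treeʳ σ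
    claim-stepˡ k σ k≡ p a a-free =
      ~-trans (tree-⊕ k σ′ (ℕ.suc-injective (trans k≡ (#free-claim σ _ p a-free))))
              (~-cong-⊞ (~-trans (tree-cong Z _ refl onZ)
                                 (tree-fuel Z _ (trans (#free-cong onZ) (cong pred (sym (#free-claim (restrictˡ σ) a p a-free))))))
                        (~-trans (tree-cong X _ refl onX) (tree-fuel X _ (#free-cong onX))))
      where
      σ′ = claim σ (a ↑ˡ size X) p
      onZ = restrictˡ-claimˡ σ a p
      onX = restrictʳ-claimˡ σ a p

    claim-stepʳ : ∀ k σ → suc k ≡ #free σ → ∀ p b → σ (size Z ↑ʳ b) ≡ free →
      tree (Z ⊕ X) k (claim σ (size Z ↑ʳ b) p) ~ treeˡ σ ⊞ tree X (pred (#free (restrictʳ σ))) (claim (restrictʳ σ) b p)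
    claim-stepʳ k σ k≡ p b b-free =
      ~-trans (tree-⊕ k σ′ (ℕ.suc-injective (trans k≡ (#free-claim σ _ p b-free))))
              (~-cong-⊞ (~-trans (tree-cong Z _ refl onZ) (tree-fuel Z _ (#free-cong onZ)))
                        (~-trans (tree-cong X _ refl onX)
                                 (tree-fuel X _ (trans (#free-cong onX) (cong pred (sym (#free-claim (restrictʳ σ) b p b-free)))))))
      where
      σ′ = claim σ (size Z ↑ʳ b) p
      onZ = restrictˡ-claimʳ σ b p
      onX = restrictʳ-claimʳ σ b p

-- Opaque because otherwise unifying two game trees normalises them completely.
opaque
  gameTree : Game → Tree
  gameTree G = tree G (size G) (λ _ → free)

  fma-gameTree : ∀ G → FirstMoverAdvantage (gameTree G)
  fma-gameTree G = fma-tree G (size G) _ (sym (#free-allFree (size G)))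

  gameTree-values : ∀ G → (Lv (gameTree G) ≡ Ls G) × (Rv (gameTree G) ≡ Rs G)
  gameTree-values G = tree-values G (size G) (λ _ → free)

  gameTree-⊕ : ∀ Z X → gameTree (Z ⊕ X) ~ gameTree Z ⊞ gameTree X
  gameTree-⊕ Z X =
    ~-trans (tree-⊕ Z X (size Z + size X) _ (sym (#free-allFree (size Z + size X))))
            (~-cong-⊞ (tree-fuel Z _ (#free-allFree (size Z))) (tree-fuel X _ (#free-allFree (size X))))

≈g-of-≈ : ∀ {X Y} → gameTree X ≈ gameTree Y → X ≈g Y
≈g-of-≈ {X} {Y} X≈Y Z =
  let (l , r) = X≈Y (gameTree Z) (fma-gameTree Z)
      (lX , rX) = values-⊕ X
      (lY , rY) = values-⊕ Y
  in trans lX (trans l (sym lY)) , trans rX (trans r (sym rY))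
  where
  values-⊕ : ∀ X → (Ls (Z ⊕ X) ≡ Lv (gameTree Z ⊞ gameTree X)) × (Rs (Z ⊕ X) ≡ Rv (gameTree Z ⊞ gameTree X))
  values-⊕ X =
    let (l , r) = gameTree-values (Z ⊕ X) ; (l′ , r′) = ~-values (gameTree-⊕ Z X) in
    trans (sym l) l′ , trans (sym r) r′

≈g-sym : ∀ {X Y} → X ≈g Y → Y ≈g X
≈g-sym X≈Y Z = let (l , r) = X≈Y Z in sym l , sym r

≈g-trans : ∀ {X Y Z} → X ≈g Y → Y ≈g Z → X ≈g Z
≈g-trans X≈Y Y≈Z W = let (l , r) = X≈Y W ; (l′ , r′) = Y≈Z W in trans l l′ , trans r r′

gameTree-number : ∀ X k → Ls X ≡ k → Rs X ≡ k → gameTree X ≈ leaf k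
gameTree-number X k eL eR =
  let (l , r) = gameTree-values X in ≈-leaf (gameTree X) k (fma-gameTree X) (trans l eL) (trans r eR)

≈g-const : ∀ X k → Ls X ≡ k → Rs X ≡ k → X ≈g const k
≈g-const X k eL eR = ≈g-of-≈ (≈-trans (gameTree-number X k eL eR) (≈-sym (gameTree-number (const k) k refl refl)))

-- The canonical form {{2 | 1} | 0} of P^L_5.
P5-reduced : Tree
P5-reduced = node 0ℤ 1 (λ _ → node 0ℤ 1 (λ _ → leaf (+ 2)) (λ _ → leaf (+ 1))) (λ _ → leaf 0ℤ)

fma-P5-reduced : FirstMoverAdvantage P5-reduced
fma-P5-reduced = +≤+ z≤n , (λ _ → +≤+ (s≤s z≤n) , (λ _ → fma-leaf _) , (λ _ → fma-leaf _)) , (λ _ → fma-leaf _)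

-- Decided by evaluation, which needs gameTree unfolded.
opaque
  unfolding gameTree

  gameTree-P4≈P3 : gameTree (PL 4) ≈ gameTree (PL 3)
  gameTree-P4≈P3 = ≈-of-difference (gameTree (PL 4)) (gameTree (PL 3)) (fma-gameTree (PL 4)) (fma-gameTree (PL 3)) refl refl

  P5≈P5-reduced : gameTree (PL 5) ≈ P5-reduced
  P5≈P5-reduced = ≈-of-difference (gameTree (PL 5)) P5-reduced (fma-gameTree (PL 5)) fma-P5-reduced refl refl

  reduced-sum-values : let S = ((gameTree (const 0ℤ) ⊞ P5-reduced) ⊞ P5-reduced) ⊞ gameTree (PL 3) in
    (Lv S ≡ + 2) × (Rv S ≡ + 2)
  reduced-sum-values = refl , refl

twoP5+P3≈2 : (copies 2 (PL 5) ⊕ PL 3) ≈g const (+ 2)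
twoP5+P3≈2 = ≈g-of-≈
  (≈-trans (~⇒≈ unfolded)
  (≈-trans reduce
  (≈-trans (≈-leaf (((T0 ⊞ Q) ⊞ Q) ⊞ T3) (+ 2) (fma-⊞ _ T3 aQQ (fma-gameTree (PL 3)))
                   (proj₁ reduced-sum-values) (proj₂ reduced-sum-values))
           (≈-sym (gameTree-number (const (+ 2)) (+ 2) refl refl)))))
  where
  T0 = gameTree (const 0ℤ)
  T3 = gameTree (PL 3)
  T5 = gameTree (PL 5)
  Q = P5-reduced
  a0 = fma-gameTree (const 0ℤ)
  a5 = fma-gameTree (PL 5)
  aQ : FirstMoverAdvantage (T0 ⊞ Q)
  aQ = fma-⊞ T0 Q a0 fma-P5-reduced
  aQQ : FirstMoverAdvantage ((T0 ⊞ Q) ⊞ Q)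
  aQQ = fma-⊞ (T0 ⊞ Q) Q aQ fma-P5-reduced
  unfolded : gameTree (copies 2 (PL 5) ⊕ PL 3) ~ ((T0 ⊞ T5) ⊞ T5) ⊞ T3
  unfolded = ~-trans (gameTree-⊕ (copies 2 (PL 5)) (PL 3))
               (~-cong-⊞ (~-trans (gameTree-⊕ (copies 1 (PL 5)) (PL 5))
                                  (~-cong-⊞ (gameTree-⊕ (const 0ℤ) (PL 5)) (~-refl T5)))
                         (~-refl T3))
  reduce : ((T0 ⊞ T5) ⊞ T5) ⊞ T3 ≈ ((T0 ⊞ Q) ⊞ Q) ⊞ T3
  reduce = ≈-cong-⊞ aQQ (fma-gameTree (PL 3)) (≈-cong-⊞ aQ a5 (≈-cong-⊞ a0 a5 ≈-refl P5≈P5-reduced) P5≈P5-reduced) ≈-refl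

mainTheorem17 :
    (PL 1 ≈g PL 2) × (PL 1 ≈g const (+ 0)) × (PL 2 ≈g const (+ 0))
    × (copies 2 (PL 3) ≈g const (+ 1))
    × (PL 4 ≈g PL 3)
    × ((copies 2 (PL 5) ⊕ PL 3) ≈g const (+ 2))
mainTheorem17 =
  ≈g-trans P1≈0 (≈g-sym P2≈0) , P1≈0 , P2≈0 ,
  ≈g-const (copies 2 (PL 3)) (+ 1) refl refl ,
  ≈g-of-≈ gameTree-P4≈P3 ,
  twoP5+P3≈2
  where
  P1≈0 : PL 1 ≈g const (+ 0)
  P1≈0 = ≈g-const (PL 1) (+ 0) refl refl
  P2≈0 : PL 2 ≈g const (+ 0)
  P2≈0 = ≈g-const (PL 2) (+ 0) refl refl
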